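{- Let $(H,\omega)$ be an edge-weighted graph with positive integer weights and let $(G,\mathcal S)=(G(H,\omega),\mathcal S(H,\omega))$. If $(G,\mathcal S)$ admits a tree mapping $(T,f)$ of sim-value $t$, then $(H,\omega)$ admits a $t$-balancing tree.
   Context: Construction of $(G(H,\omega),\mathcal S(H,\omega))$: for each ordered pair $(u,v)$ with $uv\in E(H)$, add an independent set $I(u,v)$ of $\omega(uv)$ new vertices; let $S(u)=\bigcup_{v\in N_H(u)}I(u,v)$ and $\mathcal S=\{S(u):u\in V(H)\}$. Dummy edges: for every two edges $uv,xy$ of $H$ sharing no endpoint, every vertex of $I(u,v)$ is joined to every vertex of $I(x,y)$ (for all orientations). Matching edges: for every $uv\in E(H)$, a perfect matching between $I(u,v)$ and $I(v,u)$. These are all the edges of $G$. A tree mapping of $(G,\mathcal S)$ is a pair $(T,f)$ with $T$ a tree and $f:\mathcal S\to V(T)$ a bijection; each $e\in E(T)$ defines the cut $(A_e,B_e)$ of $V(G)$ given by the unions of parts mapped to the two components of $T-e$; its sim-value is the maximum over $e$ of the maximum size of an induced matching of $G$ all of whose edges go between $A_e$ and $B_e$. A $t$-balancing tree of $(H,\omega)$ is a pair $(T',f')$, $T'$ a tree and $f':V(H)\to V(T')$ a bijection, such that for every $v\in V(H)$ and every edge $e$ of $T'$ incident to $f'(v)$, the total weight of the edges of $H$ incident to $v$ crossing the bipartition of $V(H)$ defined by the two components of $T'-e$ is at most $t$. -}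

module Defs where

open import Data.Nat using (ℕ; zero; suc; _+_; _≤_)
open import Data.Fin using (Fin; toℕ)
import Data.Fin as F
open import Data.Bool using (Bool; true; false; if_then_else_)
open import Data.Product using (Σ; Σ-syntax; _×_; _,_; proj₁; ∃; ∃-syntax)
open import Data.Sum using (_⊎_)
open import Relation.Binary.PropositionalEquality using (_≡_; _≢_)
open import Relation.Nullary using (¬_)
open import Function.Bundles using (_⤖_; Bijection)

-- Edge-weighted graphs with positive integer weights.
-- Vertex set Fin n; ω u v is the weight of the edge uv, and ω u v ≡ 0
-- encodes "uv is not an edge".  Hence every edge has positive weight.

record WGraph (n : ℕ) : Set where
  field
    ω      : Fin n → Fin n → ℕ
    ω-sym  : ∀ u v → ω u v ≡ ω v u
    ω-loop : ∀ u → ω u u ≡ 0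

open WGraph public

data Reach {m : ℕ} (adj : Fin m → Fin m → Set) : Fin m → Fin m → Set where
  here : ∀ {x} → Reach adj x x
  step : ∀ {x y z} → adj x y → Reach adj y z → Reach adj x z

removeEdge : {m : ℕ} → (Fin m → Fin m → Set) → Fin m → Fin m → Fin m → Fin m → Set
removeEdge adj a b x y = adj x y × ¬ ((x ≡ a × y ≡ b) ⊎ (x ≡ b × y ≡ a))

record Tree (m : ℕ) : Set₁ where
  field
    adj       : Fin m → Fin m → Set
    adj-sym   : ∀ {x y} → adj x y → adj y x
    adj-irr   : ∀ {x} → ¬ adj x x
    connected : ∀ x y → Reach adj x y
    acyclic   : ∀ {a b} → adj a b → ¬ Reach (removeEdge adj a b) a b

open Tree public

-- For an edge ab of T, the two components of T - ab:
-- side a = the component containing a, side b = the one containing b.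
Side : {m : ℕ} → Tree m → Fin m → Fin m → Fin m → Set
Side T a b x = Reach (removeEdge (adj T) a b) a x

-- vertices of G: (u , v , i) with i ∈ I(u,v), |I(u,v)| = ω(uv)
-- (empty when uv is not an edge)
VG : {n : ℕ} → WGraph n → Set
VG {n} H = Σ[ u ∈ Fin n ] Σ[ v ∈ Fin n ] Fin (ω H u v)

part : {n : ℕ} {H : WGraph n} → VG H → Fin n
part (u , _ , _) = u

DummyEdge : {n : ℕ} {H : WGraph n} → VG H → VG H → Set
DummyEdge (u , v , _) (x , y , _) = u ≢ x × u ≢ y × v ≢ x × v ≢ y

MatchEdge : {n : ℕ} {H : WGraph n} → VG H → VG H → Set
MatchEdge (u , v , i) (x , y , j) = x ≡ v × y ≡ u × toℕ i ≡ toℕ j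

GAdj : {n : ℕ} {H : WGraph n} → VG H → VG H → Set
GAdj {H = H} p q = DummyEdge {H = H} p q ⊎ MatchEdge {H = H} p q

record TreeMapping {n : ℕ} (H : WGraph n) : Set₁ where
  field
    m    : ℕ
    T    : Tree m
    f    : Fin n ⤖ Fin m

open TreeMapping public

fpos : {n : ℕ} {H : WGraph n} (M : TreeMapping H) → Fin n → Fin (m M)
fpos M u = Bijection.to (f M) u

InSide : {n : ℕ} {H : WGraph n} (M : TreeMapping H) → Fin (m M) → Fin (m M) → VG H → Set
InSide {H = H} M a b p = Side (T M) a b (fpos M (part {H = H} p))

Crosses : {n : ℕ} {H : WGraph n} (M : TreeMapping H) → Fin (m M) → Fin (m M) → VG H → VG H → Set
Crosses M a b p q = (InSide M a b p × InSide M b a q) ⊎ (InSide M b a p × InSide M a b q)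

record CrossingInducedMatching {n : ℕ} {H : WGraph n} (M : TreeMapping H)
         (a b : Fin (m M)) (k : ℕ) : Set where
  field
    src tgt  : Fin k → VG H
    isEdge   : ∀ i → GAdj {H = H} (src i) (tgt i)
    crosses  : ∀ i → Crosses M a b (src i) (tgt i)
    disj-ss  : ∀ i j → i ≢ j → src i ≢ src j
    disj-st  : ∀ i j → i ≢ j → src i ≢ tgt j
    disj-tt  : ∀ i j → i ≢ j → tgt i ≢ tgt j
    ind-ss   : ∀ i j → i ≢ j → ¬ GAdj {H = H} (src i) (src j)
    ind-st   : ∀ i j → i ≢ j → ¬ GAdj {H = H} (src i) (tgt j)
    ind-tt   : ∀ i j → i ≢ j → ¬ GAdj {H = H} (tgt i) (tgt j)

-- the sim-value of the tree mapping M is exactly t: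
-- (the maximum over edges e of T of the maximum size of an induced
-- matching crossing (A_e,B_e); max over the empty set of edges is 0)
HasSimValue : {n : ℕ} {H : WGraph n} → TreeMapping H → ℕ → Set
HasSimValue M t =
  (∀ a b → adj (T M) a b → ∀ k → CrossingInducedMatching M a b k → k ≤ t)
  × ((Σ[ a ∈ Fin (m M) ] Σ[ b ∈ Fin (m M) ] (adj (T M) a b × CrossingInducedMatching M a b t))
     ⊎ ((∀ a b → ¬ adj (T M) a b) × t ≡ 0))

sumFin : (k : ℕ) → (Fin k → ℕ) → ℕ
sumFin zero    g = 0
sumFin (suc k) g = g F.zero + sumFin k (λ i → g (F.suc i))

record BalancingTree {n : ℕ} (H : WGraph n) (t : ℕ) : Set₁ where
  field
    m′   : ℕ
    T′   : Tree m′
    f′   : Fin n ⤖ Fin m′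
    -- The other side is given by its indicator X.
    balanced : ∀ v c → adj T′ (Bijection.to f′ v) c →
               (X : Fin n → Bool) →
               (∀ w → X w ≡ true → Side T′ c (Bijection.to f′ v) (Bijection.to f′ w)) →
               (∀ w → Side T′ c (Bijection.to f′ v) (Bijection.to f′ w) → X w ≡ true) →
               sumFin n (λ w → if X w then ω H v w else 0) ≤ t

{-# OPTIONS --safe #-}
module Submission where

open import Defs
open import Data.Nat using (ℕ; suc; _+_)
open import Data.Fin using (Fin; toℕ; splitAt; join; cast)
import Data.Fin as F
open import Data.Fin.Properties using (join-splitAt; toℕ-cast; toℕ-injective; suc-injective; ¬Fin0)
open import Data.Bool using (Bool; true; if_then_else_)
open import Data.Product using (Σ-syntax; _,_; proj₁; proj₂)
import Data.Product as Σ
open import Data.Sum using (inj₁; inj₂; [_,_]′)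
open import Function using (_∘_; id)
open import Data.Empty using (⊥-elim)
open import Relation.Nullary using (¬_)
open import Relation.Binary.PropositionalEquality

-- The same tree is balancing.  Fix v and an edge f(v)c of T.  The matching
-- edges between I(v,w) and I(w,v), over all w on the c-side, cross the cut
-- of that edge and form an induced matching: their ends in I(v,·) lie in S(v)
-- and their other ends in sets I(·,v), neither of which spans an edge of G,
-- and an edge of G between the two families is either a dummy edge
-- (impossible, as both ends involve v) or one of the matching edges itself.
-- The matching has as many edges as the weight of v towards the c-side.

splitAt-injective : ∀ m {n} {i j : Fin (m + n)} → splitAt m i ≡ splitAt m j → i ≡ j
splitAt-injective m {n} {i} {j} eq = begin
  i                      ≡⟨ join-splitAt m n i ⟨
  join m n (splitAt m i) ≡⟨ cong (join m n) eq ⟩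
  join m n (splitAt m j) ≡⟨ join-splitAt m n j ⟩
  j                      ∎
  where open ≡-Reasoning

block : ∀ k (g : Fin k → ℕ) → Fin (sumFin k g) → Σ[ w ∈ Fin k ] Fin (g w)
block (suc k) g i = [ F.zero ,_ , Σ.map F.suc id ∘ block k (g ∘ F.suc) ]′ (splitAt (g F.zero) i)

block-injective : ∀ k (g : Fin k → ℕ) {i j : Fin (sumFin k g)} →
                  proj₁ (block k g i) ≡ proj₁ (block k g j) →
                  toℕ (proj₂ (block k g i)) ≡ toℕ (proj₂ (block k g j)) → i ≡ j
block-injective (suc k) g {i} {j} eq₁ eq₂
  with splitAt (g F.zero) i in split-i | splitAt (g F.zero) j in split-j
... | inj₁ l | inj₁ l′ =
  splitAt-injective (g F.zero) (trans split-i (trans (cong inj₁ (toℕ-injective eq₂)) (sym split-j)))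
... | inj₂ i′ | inj₂ j′ =
  splitAt-injective (g F.zero)
    (trans split-i (trans (cong inj₂ (block-injective k (g ∘ F.suc) (suc-injective eq₁) eq₂)) (sym split-j)))
block-injective (suc k) g () _ | inj₁ _ | inj₂ _
block-injective (suc k) g () _ | inj₂ _ | inj₁ _

Fin-if⇒true : ∀ b {x} → Fin (if b then x else 0) → b ≡ true
Fin-if⇒true true _ = refl

fromFin-if : ∀ b {x} → Fin (if b then x else 0) → Fin x
fromFin-if true l = l

toℕ-fromFin-if : ∀ b {x} (l : Fin (if b then x else 0)) → toℕ (fromFin-if b l) ≡ toℕ l
toℕ-fromFin-if true l = refl

module _ {n : ℕ} (H : WGraph n) where

  opposite : VG H → Fin n
  opposite (_ , w , _) = w

  label : VG H → ℕ
  label (_ , _ , l) = toℕ l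

  partner : VG H → VG H
  partner (u , w , l) = w , u , cast (ω-sym H u w) l

  VG-≡ : ∀ {p q : VG H} → part {H = H} p ≡ part {H = H} q → opposite p ≡ opposite q →
         label p ≡ label q → p ≡ q
  VG-≡ {_ , _ , l} {_ , _ , l′} refl refl eq = cong (λ l → _ , _ , l) (toℕ-injective eq)

  part≢opposite : (p : VG H) → part {H = H} p ≢ opposite p
  part≢opposite (u , _ , l) refl = ¬Fin0 (subst Fin (ω-loop H u) l)

  label-partner : (p : VG H) → label (partner p) ≡ label p
  label-partner (u , w , l) = toℕ-cast (ω-sym H u w) l

  partner-matched : (p : VG H) → MatchEdge {H = H} p (partner p)
  partner-matched p = refl , refl , sym (label-partner p)

  MatchEdge⇒≡partner : ∀ {p q : VG H} → MatchEdge {H = H} p q → q ≡ partner p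
  MatchEdge⇒≡partner {p} (part≡ , opposite≡ , label≡) =
    VG-≡ part≡ opposite≡ (trans (sym label≡) (sym (label-partner p)))

  partner-injective : ∀ {p q : VG H} → partner p ≡ partner q → p ≡ q
  partner-injective {p} {q} eq = VG-≡ (cong opposite eq) (cong (part {H = H}) eq) (begin
    label p           ≡⟨ label-partner p ⟨
    label (partner p) ≡⟨ cong label eq ⟩
    label (partner q) ≡⟨ label-partner q ⟩
    label q           ∎)
    where open ≡-Reasoning

  same-part⇒¬GAdj : ∀ {p q : VG H} → part {H = H} p ≡ part {H = H} q → ¬ GAdj {H = H} p q
  same-part⇒¬GAdj eq (inj₁ (u≢x , _)) = u≢x eq
  same-part⇒¬GAdj {p} eq (inj₂ (x≡v , _)) = part≢opposite p (trans eq x≡v)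

  same-opposite⇒¬GAdj : ∀ {p q : VG H} → opposite p ≡ opposite q → ¬ GAdj {H = H} p q
  same-opposite⇒¬GAdj eq (inj₁ (_ , _ , _ , v≢y)) = v≢y eq
  same-opposite⇒¬GAdj {p} eq (inj₂ (_ , y≡u , _)) = part≢opposite p (sym (trans eq y≡u))

  GAdj-partner⇒≡ : ∀ {p q : VG H} → part {H = H} p ≡ part {H = H} q →
                   GAdj {H = H} p (partner q) → p ≡ q
  GAdj-partner⇒≡ eq (inj₁ (_ , u≢y , _)) = ⊥-elim (u≢y eq)
  GAdj-partner⇒≡ eq (inj₂ match) = sym (partner-injective (MatchEdge⇒≡partner match))

module _ {n : ℕ} (H : WGraph n) (M : TreeMapping H) (v : Fin n) (c : Fin (m M))
         (X : Fin n → Bool)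
         (X⇒c-side : ∀ w → X w ≡ true → Side (T M) c (fpos M v) (fpos M w)) where

  weightTowards : Fin n → ℕ
  weightTowards w = if X w then ω H v w else 0

  starVertex : Fin (sumFin n weightTowards) → VG H
  starVertex i = let (w , l) = block n weightTowards i in v , w , fromFin-if (X w) l

  starVertex-on-c-side : ∀ i → X (opposite H (starVertex i)) ≡ true
  starVertex-on-c-side i = let (w , l) = block n weightTowards i in Fin-if⇒true (X w) l

  label-starVertex : ∀ i → label H (starVertex i) ≡ toℕ (proj₂ (block n weightTowards i))
  label-starVertex i = let (w , l) = block n weightTowards i in toℕ-fromFin-if (X w) l

  starVertex-injective : ∀ {i j} → starVertex i ≡ starVertex j → i ≡ j
  starVertex-injective {i} {j} eq = block-injective n weightTowards (cong (opposite H) eq)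
    (trans (sym (label-starVertex i)) (trans (cong (label H) eq) (label-starVertex j)))

  starMatching : CrossingInducedMatching M (fpos M v) c (sumFin n weightTowards)
  starMatching = record
    { src     = starVertex
    ; tgt     = partner H ∘ starVertex
    ; isEdge  = λ i → inj₂ (partner-matched H (starVertex i))
    ; crosses = λ i → inj₁ (here , X⇒c-side _ (starVertex-on-c-side i))
    ; disj-ss = λ i j i≢j → i≢j ∘ starVertex-injective
    ; disj-st = λ i j _ eq → part≢opposite H (starVertex j) (cong (part {H = H}) eq)
    ; disj-tt = λ i j i≢j → i≢j ∘ starVertex-injective ∘ partner-injective H
    ; ind-ss  = λ i j _ → same-part⇒¬GAdj H refl
    ; ind-st  = λ i j i≢j → i≢j ∘ starVertex-injective ∘ GAdj-partner⇒≡ H refl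
    ; ind-tt  = λ i j _ → same-opposite⇒¬GAdj H refl
    }

lemma22 : (n : ℕ) (H : WGraph n) (t : ℕ) (M : TreeMapping H) →
          HasSimValue M t → BalancingTree H t
lemma22 n H t M (sim≤t , _) = record
  { m′       = m M
  ; T′       = T M
  ; f′       = f M
  ; balanced = λ v c fv-c X X⇒c-side _ →
      sim≤t (fpos M v) c fv-c _ (starMatching H M v c X X⇒c-side)
  }
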